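{- Let $S_0\subseteq S^*\subseteq F$ be sets of facilities and let $\mu$ be an arbitrary (not necessarily optimal) assignment of each client to a facility of $S^*$; for $f\in S^*$ let $C_\mu(f)$ be the set of clients assigned to $f$ by $\mu$. Then the cost $o(S'')+d(S'')$ (with original opening costs and each client served by its closest facility) of the solution $S''=$\texttt{Extend-JMS}$(S_0)$ is at most $$o(S^*)+\sum_{f\in S_0}\sum_{c\in C_\mu(f)}dist(c,f)+2\sum_{f\in S^*\setminus S_0}\sum_{c\in C_\mu(f)}dist(c,f).$$
   Context: UFL instance: clients $C$, facilities $F$, metric $dist$ on $C\cup F$, opening costs $o:F\to\mathbb{R}_{\ge0}$; $o(S)=\sum_{f\in S}o(f)$, $d(S)=\sum_{j\in C}\min_{f\in S}dist(j,f)$. JMS algorithm: maintain active clients $A$ (initially $C$), open facilities $S$ (initially $\emptyset$), values $\alpha_j$ (initially $0$), and for each inactive client $j$ a facility $S(j)$. Each client $j$ offers to each closed facility $f$ the amount $\max\{0,\alpha_j-dist(j,f)\}$ if $j$ is active and $\max\{0,dist(j,S(j))-dist(j,f)\}$ otherwise. Raise all $\alpha_j$ of active clients uniformly until: if $\alpha_j=dist(j,f)$ for an active $j$ and an open $f$, $j$ becomes inactive with $S(j)=f$; if the offers to a closed $f$ reach its opening cost, open $f$ and set $S(j)=f$ (making $j$ inactive) for every client making a strictly positive offer to $f$. Stop when no client is active and output $S$. \texttt{Extend-JMS}$(X)$: modify the instance so that every facility in $X$ has opening cost $0$ (other costs unchanged), run JMS on the modified instance, and return its output.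
   Formalization: The metric $dist$ and the opening costs $o$ take values in the rationals rather than the reals. -}

module Defs where

open import Data.Nat using (ℕ; zero; suc)
open import Data.Fin using (Fin; zero; suc; _≟_)
open import Data.Fin.Subset using (Subset; _∈_; _∉_; _⊆_; ⊥; ⁅_⁆; _∪_; _─_)
open import Data.Vec using (Vec; []; _∷_; lookup)
open import Data.Bool using (Bool; true; false; if_then_else_)
open import Data.Maybe using (Maybe; just; nothing; fromMaybe)
open import Data.Sum using (_⊎_; inj₁; inj₂)
open import Data.Product using (Σ; ∃; _×_; _,_)
open import Data.Rational using (ℚ; 0ℚ; 1ℚ; _+_; _-_; _*_; _⊔_; _⊓_; _≤_; _<_; _<?_)
open import Relation.Binary.PropositionalEquality using (_≡_)
open import Relation.Nullary using (¬_; yes; no)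
open import Relation.Nullary.Decidable using (⌊_⌋)
open import Relation.Binary.Construct.Closure.ReflexiveTransitive using (Star)

∑ : ∀ {k} → (Fin k → ℚ) → ℚ
∑ {zero}  g = 0ℚ
∑ {suc k} g = g zero + ∑ (λ i → g (suc i))

∑∈ : ∀ {k} → Subset k → (Fin k → ℚ) → ℚ
∑∈ S g = ∑ (λ i → if lookup S i then g i else 0ℚ)

minIn : ∀ {k} → Subset k → (Fin k → ℚ) → Maybe ℚ
minIn {zero}  []      g = nothing
minIn {suc k} (b ∷ S) g with b | minIn S (λ i → g (suc i))
... | true  | just r  = just (g zero ⊓ r)
... | true  | nothing = just (g zero)
... | false | r       = r

-- UFL instances: n clients (Fin n), m facilities (Fin m),
-- a metric on C ∪ F (points Fin n ⊎ Fin m), opening costs o.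

Point : ℕ → ℕ → Set
Point n m = Fin n ⊎ Fin m

record UFL (n m : ℕ) : Set where
  field
    dist      : Point n m → Point n m → ℚ
    dist-self : ∀ x → dist x x ≡ 0ℚ
    dist-nonneg : ∀ x y → 0ℚ ≤ dist x y
    dist-sym  : ∀ x y → dist x y ≡ dist y x
    dist-tri  : ∀ x y z → dist x z ≤ dist x y + dist y z
    cost      : Fin m → ℚ
    cost-nonneg : ∀ f → 0ℚ ≤ cost f

module _ {n m : ℕ} (I : UFL n m) where
  open UFL I

  dcf : Fin n → Fin m → ℚ
  dcf j f = dist (inj₁ j) (inj₂ f)

  o : Subset m → ℚ
  o S = ∑∈ S cost

  -- min_{f∈S} dist(j,f)  (convention: 0 if S is empty; never used
  -- for the empty set in the theorem when there are clients)
  closest : Fin n → Subset m → ℚ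
  closest j S = fromMaybe 0ℚ (minIn S (dcf j))

  d : Subset m → ℚ
  d S = ∑ (λ j → closest j S)

-- The JMS algorithm, as a (nondeterministic in tie-breaking)
-- transition system, run with an arbitrary opening cost function oc.

-- status j = nothing     : j is active
-- status j = just f      : j is inactive with S(j) = f
record JMSState (n m : ℕ) : Set where
  constructor mkState
  field
    status : Fin n → Maybe (Fin m)
    opened : Subset m
    α      : Fin n → ℚ
open JMSState public

initState : ∀ {n m} → JMSState n m
initState = mkState (λ _ → nothing) ⊥ (λ _ → 0ℚ)

module JMS {n m : ℕ} (I : UFL n m) (oc : Fin m → ℚ) where
  open UFL I

  offer : JMSState n m → Fin n → Fin m → ℚ
  offer s j f with status s j
  ... | nothing = 0ℚ ⊔ (α s j - dcf I j f)
  ... | just g  = 0ℚ ⊔ (dcf I j g - dcf I j f)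

  offers : JMSState n m → Fin m → ℚ
  offers s f = ∑ (λ j → offer s j f)

  HasActive : JMSState n m → Set
  HasActive s = ∃ λ j → status s j ≡ nothing

  Pending : JMSState n m → Set
  Pending s = (∃ λ j → ∃ λ f → status s j ≡ nothing × f ∈ opened s × dcf I j f ≤ α s j)
            ⊎ (∃ λ f → f ∉ opened s × oc f ≤ offers s f)

  connect : JMSState n m → Fin n → Fin m → JMSState n m
  connect s j f = mkState st (opened s) (α s)
    where
    st : Fin n → Maybe (Fin m)
    st i with i ≟ j
    ... | yes _ = just f
    ... | no  _ = status s i

  openF : JMSState n m → Fin m → JMSState n m
  openF s f = mkState st (⁅ f ⁆ ∪ opened s) (α s)
    where
    st : Fin n → Maybe (Fin m)
    st i with 0ℚ <? offer s i f
    ... | yes _ = just f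
    ... | no  _ = status s i

  raise : JMSState n m → ℚ → JMSState n m
  raise s δ = mkState (status s) (opened s) a
    where
    a : Fin n → ℚ
    a i with status s i
    ... | nothing = α s i + δ
    ... | just _  = α s i

  data Step : JMSState n m → JMSState n m → Set where
    connectStep : ∀ {s} j f → status s j ≡ nothing → f ∈ opened s →
                  α s j ≡ dcf I j f → Step s (connect s j f)
    openStep    : ∀ {s} f → f ∉ opened s → oc f ≤ offers s f →
                  Step s (openF s f)
    raiseStep   : ∀ {s} δ → 0ℚ < δ → ¬ Pending s →
                  (∀ j f → status s j ≡ nothing → f ∈ opened s →
                     α (raise s δ) j ≤ dcf I j f) →
                  (∀ f → f ∉ opened s → offers (raise s δ) f ≤ oc f) →
                  Step s (raise s δ)

  ActiveStep : JMSState n m → JMSState n m → Set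
  ActiveStep s s' = HasActive s × Step s s'

  Terminal : JMSState n m → Set
  Terminal s = ∀ j → ∃ λ f → status s j ≡ just f

  Output : Subset m → Set
  Output S = ∃ λ s → Star ActiveStep initState s × Terminal s × opened s ≡ S

-- Extend-JMS(X): opening costs set to 0 on X
extCost : ∀ {n m} → UFL n m → Subset m → Fin m → ℚ
extCost I X f = if lookup X f then 0ℚ else UFL.cost I f

ExtendJMSOutput : ∀ {n m} → UFL n m → Subset m → Subset m → Set
ExtendJMSOutput I X S = JMS.Output I (extCost I X) S

assignedCost : ∀ {n m} → UFL n m → (Fin n → Fin m) → Fin m → ℚ
assignedCost I μ f = ∑ (λ c → if ⌊ μ c ≟ f ⌋ then dcf I c f else 0ℚ)

2ℚ : ℚ
2ℚ = 1ℚ + 1ℚ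

-- Dual fitting. A client bids α_j while active and dist(j,S(j)) once connected; it has then paid
-- α_j − bid_j towards opening costs, and these payments cover the (modified) opening costs of
-- the open facilities, so at termination o'(S'') + d(S'') ≤ ∑_j α_j, where o' are the costs seen
-- by Extend-JMS(S₀), and o(S'') ≤ o'(S'') + o(S₀). Grouping the clients by μ leaves, for each
-- f ∈ S*, the sum of α_j over C_μ(f). If f ∈ S₀ it is free, so no α_j ever exceeds dist(j,f).
-- Otherwise the star inequality ∑_{j∈T} α_j ≤ o(f) + 2 ∑_{j∈T} dist(j,f) of JMS applies: while f is
-- closed, an active client i sees each j ∈ T offer f at least α_i − dist(j,f), or
-- α_i − dist(i,f) − 2 dist(j,f) if j is already connected, and these offers total at most o(f);
-- an invariant over the run turns these bounds, taken at the moments the clients of T connect,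
-- into the star inequality.

module Submission where

open import Defs
open import Algebra.Bundles using (CommutativeRing)
import Algebra.Properties.Semiring.Sum as SemiringSum
open import Data.Bool using (Bool; true; false; if_then_else_; _∧_; not)
open import Data.Bool.Properties using (∧-conicalʳ; ∧-zeroʳ; ∧-identityʳ) renaming (_≟_ to _≟ᵇ_)
open import Data.Empty using (⊥-elim)
open import Data.Nat using (zero; suc)
open import Data.Fin using (Fin; zero; suc; _≟_)
open import Data.Fin.Properties using (any?)
open import Data.Fin.Subset using (Subset; _∈_; _∉_; _⊆_; ⁅_⁆; _∪_; _─_)
open import Data.Fin.Subset.Properties
  using (x∈p∪q⁺; x∈p∪q⁻; x∈⁅x⁆; x∈⁅y⁆⇒x≡y; x∈p∧x∉q⇒x∈p─q; ∉⊥; ∪-identityˡ; drop-not-there; _∈?_)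
open import Data.Maybe using (Maybe; just; nothing; is-just)
open import Data.Product using (∃; _×_; _,_; proj₂)
open import Data.Rational using (ℚ; 0ℚ; 1ℚ; _+_; _-_; _*_; _⊔_; _⊓_; _≤_; _<_; -_; _<?_; nonNegative; positive)
open import Data.Rational.Properties hiding (_≟_)
open import Data.Rational.Solver using (module +-*-Solver)
open import Data.Sum using (_⊎_; inj₁; inj₂)
open import Data.Vec using (_∷_; lookup; here; there)
open import Data.Vec.Properties using ([]=⇒lookup; lookup⇒[]=; lookup-replicate)
open import Relation.Binary.Construct.Closure.ReflexiveTransitive using (Star; ε; _◅_)
open import Relation.Binary.PropositionalEquality
open import Function using (case_of_)
open import Relation.Nullary using (¬_; yes; no)
open import Relation.Nullary.Decidable using (⌊_⌋)
open +-*-Solver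

0≤2 : 0ℚ ≤ 2ℚ
0≤2 = nonNegative⁻¹ 2ℚ

*-nonNeg : ∀ {p q} → 0ℚ ≤ p → 0ℚ ≤ q → 0ℚ ≤ p * q
*-nonNeg {p} {q} 0≤p 0≤q =
  nonNegative⁻¹ (p * q) {{nonNeg*nonNeg⇒nonNeg p {{nonNegative 0≤p}} q {{nonNegative 0≤q}}}}

p≤p+q : ∀ {p q} → 0ℚ ≤ q → p ≤ p + q
p≤p+q {p} {q} 0≤q = subst (_≤ p + q) (+-identityʳ p) (+-monoʳ-≤ p 0≤q)

p≤q⇒0≤q-p : ∀ {p q} → p ≤ q → 0ℚ ≤ q - p
p≤q⇒0≤q-p {p} {q} p≤q = subst (_≤ q - p) (+-inverseʳ p) (+-monoˡ-≤ (- p) p≤q)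

p-r≤q⇒p≤q+r : ∀ {p q r} → p - r ≤ q → p ≤ q + r
p-r≤q⇒p≤q+r {p} {q} {r} p-r≤q =
  subst (_≤ q + r) (solve 2 (λ p r → (p :- r) :+ r := p) refl p r) (+-monoˡ-≤ r p-r≤q)

p-q≤0⇒p≤q : ∀ {p q} → p - q ≤ 0ℚ → p ≤ q
p-q≤0⇒p≤q {p} {q} p-q≤0 = subst (p ≤_) (+-identityˡ q) (p-r≤q⇒p≤q+r p-q≤0)

p≤q+r⇒p-r≤q : ∀ {p q r} → p ≤ q + r → p - r ≤ q
p≤q+r⇒p-r≤q {p} {q} {r} p≤q+r =
  subst (p - r ≤_) (solve 2 (λ q r → (q :+ r) :- r := q) refl q r) (+-monoˡ-≤ (- r) p≤q+r)

0<0⊔p⇒0⊔p≡p : ∀ {p} → 0ℚ < 0ℚ ⊔ p → 0ℚ ⊔ p ≡ p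
0<0⊔p⇒0⊔p≡p {p} 0<0⊔p with ≤-total 0ℚ p
... | inj₁ 0≤p = p≤q⇒p⊔q≡q 0≤p
... | inj₂ p≤0 = ⊥-elim (<-irrefl refl (subst (0ℚ <_) (p≥q⇒p⊔q≡p p≤0) 0<0⊔p))

0≮0⊔p⇒0⊔p≡0 : ∀ {p} → ¬ 0ℚ < 0ℚ ⊔ p → 0ℚ ⊔ p ≡ 0ℚ
0≮0⊔p⇒0⊔p≡0 {p} 0≮0⊔p = ≤-antisym (≮⇒≥ 0≮0⊔p) (p≤p⊔q 0ℚ p)

-- Finite sums

module ℚSum = SemiringSum (CommutativeRing.semiring +-*-commutativeRing)

∑≡sum : ∀ {k} (g : Fin k → ℚ) → ∑ g ≡ ℚSum.sum g
∑≡sum {zero}  g = refl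
∑≡sum {suc k} g = cong (g zero +_) (∑≡sum (λ i → g (suc i)))

∑-cong : ∀ {k} {f g : Fin k → ℚ} → (∀ i → f i ≡ g i) → ∑ f ≡ ∑ g
∑-cong {f = f} {g} f≗g = trans (∑≡sum f) (trans (ℚSum.sum-cong-≗ f≗g) (sym (∑≡sum g)))

∑-zero : ∀ k → ∑ {k} (λ _ → 0ℚ) ≡ 0ℚ
∑-zero k = trans (∑≡sum {k} (λ _ → 0ℚ)) (ℚSum.sum-replicate-zero k)

∑-distrib-+ : ∀ {k} (f g : Fin k → ℚ) → ∑ (λ i → f i + g i) ≡ ∑ f + ∑ g
∑-distrib-+ f g = trans (∑≡sum (λ i → f i + g i))
  (trans (ℚSum.∑-distrib-+ f g) (sym (cong₂ _+_ (∑≡sum f) (∑≡sum g))))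

*-distribˡ-∑ : ∀ {k} (p : ℚ) (f : Fin k → ℚ) → p * ∑ f ≡ ∑ (λ i → p * f i)
*-distribˡ-∑ p f = trans (cong (p *_) (∑≡sum f))
  (trans (ℚSum.*-distribˡ-sum p f) (sym (∑≡sum (λ i → p * f i))))

∑-comm : ∀ {k l} (f : Fin k → Fin l → ℚ) →
         ∑ (λ i → ∑ (λ j → f i j)) ≡ ∑ (λ j → ∑ (λ i → f i j))
∑-comm f = begin
  ∑ (λ i → ∑ (f i))                       ≡⟨ ∑-cong (λ i → ∑≡sum (f i)) ⟩
  ∑ (λ i → ℚSum.sum (f i))                ≡⟨ ∑≡sum (λ i → ℚSum.sum (f i)) ⟩
  ℚSum.sum (λ i → ℚSum.sum (f i))         ≡⟨ ℚSum.∑-comm f ⟩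
  ℚSum.sum (λ j → ℚSum.sum (λ i → f i j)) ≡⟨ sym (∑≡sum (λ j → ℚSum.sum (λ i → f i j))) ⟩
  ∑ (λ j → ℚSum.sum (λ i → f i j))        ≡⟨ sym (∑-cong (λ j → ∑≡sum (λ i → f i j))) ⟩
  ∑ (λ j → ∑ (λ i → f i j))               ∎
  where open ≡-Reasoning

∑-mono : ∀ {k} {f g : Fin k → ℚ} → (∀ i → f i ≤ g i) → ∑ f ≤ ∑ g
∑-mono {zero}  f≤g = ≤-refl
∑-mono {suc k} f≤g = +-mono-≤ (f≤g zero) (∑-mono (λ i → f≤g (suc i)))

∑-nonNeg : ∀ {k} {f : Fin k → ℚ} → (∀ i → 0ℚ ≤ f i) → 0ℚ ≤ ∑ f
∑-nonNeg {k} {f} 0≤f = subst (_≤ ∑ f) (∑-zero k) (∑-mono 0≤f)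

term≤∑ : ∀ {k} {f : Fin k → ℚ} → (∀ i → 0ℚ ≤ f i) → ∀ j → f j ≤ ∑ f
term≤∑ {suc k} 0≤f zero    = p≤p+q (∑-nonNeg (λ i → 0≤f (suc i)))
term≤∑ {suc k} {f} 0≤f (suc j) = ≤-trans (term≤∑ (λ i → 0≤f (suc i)) j)
  (subst (_≤ ∑ f) (+-identityˡ rest) (+-monoˡ-≤ rest (0≤f zero)))
  where rest = ∑ (λ i → f (suc i))

∑-δ : ∀ {k} (a : Fin k) (x : ℚ) → ∑ (λ g → if ⌊ a ≟ g ⌋ then x else 0ℚ) ≡ x
∑-δ {suc k} zero    x = trans (cong (x +_) (∑-zero k)) (+-identityʳ x)
∑-δ {suc k} (suc a) x =
  trans (+-identityˡ _) (trans (∑-cong (λ g → cong (λ b → if b then x else 0ℚ) (suc≟suc g))) (∑-δ a x))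
  where
  suc≟suc : ∀ g → ⌊ suc a ≟ suc g ⌋ ≡ ⌊ a ≟ g ⌋
  suc≟suc g with a ≟ g
  ... | yes _ = refl
  ... | no  _ = refl

𝟙 : Bool → ℚ
𝟙 true  = 1ℚ
𝟙 false = 0ℚ

𝟙-nonNeg : ∀ b → 0ℚ ≤ 𝟙 b
𝟙-nonNeg true  = nonNegative⁻¹ 1ℚ
𝟙-nonNeg false = ≤-refl

if-then-0≡𝟙* : ∀ b x → (if b then x else 0ℚ) ≡ 𝟙 b * x
if-then-0≡𝟙* true  x = sym (*-identityˡ x)
if-then-0≡𝟙* false x = sym (*-zeroˡ x)

if-nonNeg : ∀ b {x} → 0ℚ ≤ x → 0ℚ ≤ (if b then x else 0ℚ)
if-nonNeg true  0≤x = 0≤x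
if-nonNeg false _   = ≤-refl

𝟙*-mono : ∀ b {x y} → (b ≡ true → x ≤ y) → 𝟙 b * x ≤ 𝟙 b * y
𝟙*-mono true  {x} {y} x≤y = subst₂ _≤_ (sym (*-identityˡ x)) (sym (*-identityˡ y)) (x≤y refl)
𝟙*-mono false {x} {y} _   = ≤-reflexive (trans (*-zeroˡ x) (sym (*-zeroˡ y)))

𝟙*-cong : ∀ b {x y} → (b ≡ true → x ≡ y) → 𝟙 b * x ≡ 𝟙 b * y
𝟙*-cong true          x≡y = cong (1ℚ *_) (x≡y refl)
𝟙*-cong false {x} {y} _   = trans (*-zeroˡ x) (sym (*-zeroˡ y))

𝟙-partition : ∀ t x → 𝟙 (t ∧ x) + 𝟙 (t ∧ not x) ≡ 𝟙 t
𝟙-partition true  true  = refl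
𝟙-partition true  false = refl
𝟙-partition false _     = refl

newly : Bool → Bool → Bool
newly before after = after ∧ not before

newly⇒false-before : ∀ x y → newly x y ≡ true → x ≡ false
newly⇒false-before false true _ = refl

𝟙-split-new : ∀ t x y → (x ≡ true → y ≡ true) → 𝟙 (t ∧ y) ≡ 𝟙 (t ∧ x) + 𝟙 (t ∧ newly x y)
𝟙-split-new false _     _     _   = refl
𝟙-split-new true  true  true  _   = refl
𝟙-split-new true  true  false x⇒y = case x⇒y refl of λ ()
𝟙-split-new true  false true  _   = refl
𝟙-split-new true  false false _   = refl

𝟙-split-new-not : ∀ t x y → (x ≡ true → y ≡ true) → 𝟙 (t ∧ not x) ≡ 𝟙 (t ∧ not y) + 𝟙 (t ∧ newly x y)
𝟙-split-new-not false _     _     _   = refl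
𝟙-split-new-not true  true  true  _   = refl
𝟙-split-new-not true  true  false x⇒y = case x⇒y refl of λ ()
𝟙-split-new-not true  false true  _   = refl
𝟙-split-new-not true  false false _   = refl

𝟙-case-bound : ∀ t x {a o u v} → 0ℚ ≤ o → (x ≡ true → a ≤ o + u) → (x ≡ false → a ≤ o + v) →
               𝟙 t * a ≤ o + 𝟙 (t ∧ x) * u + 𝟙 (t ∧ not x) * v
𝟙-case-bound false _ {a} {o} {u} {v} 0≤o _ _ = subst₂ _≤_
  (sym (*-zeroˡ a)) (solve 3 (λ o u v → o := o :+ con 0ℚ :* u :+ con 0ℚ :* v) refl o u v) 0≤o
𝟙-case-bound true true {a} {o} {u} {v} _ a≤o+u _ = subst₂ _≤_
  (sym (*-identityˡ a)) (solve 3 (λ o u v → o :+ u := o :+ con 1ℚ :* u :+ con 0ℚ :* v) refl o u v) (a≤o+u refl)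
𝟙-case-bound true false {a} {o} {u} {v} _ _ a≤o+v = subst₂ _≤_
  (sym (*-identityˡ a)) (solve 3 (λ o u v → o :+ v := o :+ con 0ℚ :* u :+ con 1ℚ :* v) refl o u v) (a≤o+v refl)

∑-scale : ∀ {k} p (e w : Fin k → ℚ) → p * ∑ (λ i → e i * w i) ≡ ∑ (λ i → e i * (p * w i))
∑-scale p e w = trans (*-distribˡ-∑ p (λ i → e i * w i))
  (∑-cong (λ i → solve 3 (λ p e w → p :* (e :* w) := e :* (p :* w)) refl p (e i) (w i)))

∑-linear : ∀ {k} (e u v : Fin k → ℚ) p q →
           ∑ (λ i → e i * (p * u i + q * v i)) ≡ p * ∑ (λ i → e i * u i) + q * ∑ (λ i → e i * v i)
∑-linear e u v p q = begin
  ∑ (λ i → e i * (p * u i + q * v i))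
    ≡⟨ ∑-cong (λ i → *-distribˡ-+ (e i) (p * u i) (q * v i)) ⟩
  ∑ (λ i → e i * (p * u i) + e i * (q * v i))
    ≡⟨ ∑-distrib-+ (λ i → e i * (p * u i)) (λ i → e i * (q * v i)) ⟩
  ∑ (λ i → e i * (p * u i)) + ∑ (λ i → e i * (q * v i))
    ≡⟨ sym (cong₂ _+_ (∑-scale p e u) (∑-scale q e v)) ⟩
  p * ∑ (λ i → e i * u i) + q * ∑ (λ i → e i * v i) ∎
  where open ≡-Reasoning

lookup-∉ : ∀ {k} {g : Fin k} {S : Subset k} → g ∉ S → lookup S g ≡ false
lookup-∉ {g = g} {S} g∉S with lookup S g in eq
... | true  = ⊥-elim (g∉S (lookup⇒[]= g S eq))
... | false = refl

∑∈-insert : ∀ {k} (S : Subset k) {f} (h : Fin k → ℚ) → f ∉ S → ∑∈ (⁅ f ⁆ ∪ S) h ≡ h f + ∑∈ S h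
∑∈-insert (true ∷ S)  {zero}  h f∉S = ⊥-elim (f∉S here)
∑∈-insert (false ∷ S) {zero}  h _   =
  cong (h zero +_) (trans (cong (λ S′ → ∑∈ S′ (λ i → h (suc i))) (∪-identityˡ S)) (sym (+-identityˡ _)))
∑∈-insert (b ∷ S)     {suc f} h f∉S =
  trans (cong (x +_) (∑∈-insert S (λ i → h (suc i)) (drop-not-there f∉S)))
        (solve 3 (λ x y z → x :+ (y :+ z) := y :+ (x :+ z)) refl x (h (suc f)) (∑∈ S (λ i → h (suc i))))
  where x = if b then h zero else 0ℚ

minIn-≤ : ∀ {k} (S : Subset k) (h : Fin k → ℚ) {g} → g ∈ S → ∃ λ r → minIn S h ≡ just r × r ≤ h g
minIn-≤ (true ∷ S) h here with minIn S (λ i → h (suc i))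
... | just r  = h zero ⊓ r , refl , p⊓q≤p (h zero) r
... | nothing = h zero , refl , ≤-refl
minIn-≤ (true ∷ S) h (there g∈S) with minIn S (λ i → h (suc i)) | minIn-≤ S (λ i → h (suc i)) g∈S
... | _ | r , refl , r≤h = h zero ⊓ r , refl , ≤-trans (p⊓q≤q (h zero) r) r≤h
minIn-≤ (false ∷ S) h (there g∈S) with minIn S (λ i → h (suc i)) | minIn-≤ S (λ i → h (suc i)) g∈S
... | _ | r , refl , r≤h = r , refl , r≤h

closest-≤ : ∀ {n m} (I : UFL n m) j {S g} → g ∈ S → closest I j S ≤ dcf I j g
closest-≤ I j {S} g∈S with minIn-≤ S (dcf I j) g∈S
... | r , eq , r≤ rewrite eq = r≤

dcf-detour : ∀ {n m} (I : UFL n m) i j f g → dcf I i g ≤ dcf I i f + (dcf I j f + dcf I j g)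
dcf-detour I i j f g = ≤-trans (dist-tri (inj₁ i) (inj₂ f) (inj₂ g))
  (+-monoʳ-≤ (dcf I i f) (≤-trans (dist-tri (inj₂ f) (inj₁ j) (inj₂ g))
    (≤-reflexive (cong (_+ dcf I j g) (dist-sym (inj₂ f) (inj₁ j))))))
  where open UFL I

-- Single steps of JMS

module Mechanics {n m} (I : UFL n m) (oc : Fin m → ℚ) where
  open UFL I
  open JMS I oc

  D : Fin n → Fin m → ℚ
  D = dcf I

  -- A client bids α while active and dist(j,S(j)) once connected: its offer is the positive part of
  -- bid minus distance, and α - bid is what it has paid towards opening costs.
  bidOf : Maybe (Fin m) → ℚ → Fin n → ℚ
  bidOf nothing  a j = a
  bidOf (just g) a j = D j g

  bid : JMSState n m → Fin n → ℚ
  bid s j = bidOf (status s j) (α s j) j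

  paid : JMSState n m → ℚ
  paid s = ∑ (λ j → α s j - bid s j)

  nothing-or-just : (x : Maybe (Fin m)) → x ≡ nothing ⊎ ∃ λ g → x ≡ just g
  nothing-or-just nothing  = inj₁ refl
  nothing-or-just (just g) = inj₂ (g , refl)

  frozen : JMSState n m → Fin n → Bool
  frozen s j = is-just (status s j)

  offer≡ : ∀ s j h → offer s j h ≡ 0ℚ ⊔ (bid s j - D j h)
  offer≡ s j h with status s j
  ... | nothing = refl
  ... | just _  = refl

  offer-nonNeg : ∀ s j h → 0ℚ ≤ offer s j h
  offer-nonNeg s j h = subst (0ℚ ≤_) (sym (offer≡ s j h)) (p≤p⊔q 0ℚ (bid s j - D j h))

  bid-offer : ∀ s j h → bid s j - D j h ≤ offer s j h
  bid-offer s j h = subst (bid s j - D j h ≤_) (sym (offer≡ s j h)) (p≤q⊔p 0ℚ (bid s j - D j h))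

  offer≤offers : ∀ s j h → offer s j h ≤ offers s h
  offer≤offers s j h = term≤∑ (λ i → offer-nonNeg s i h) j

  connect-status : ∀ s j g i →
    (i ≡ j × status (connect s j g) i ≡ just g) ⊎ status (connect s j g) i ≡ status s i
  connect-status s j g i with i ≟ j
  ... | yes i≡j = inj₁ (i≡j , refl)
  ... | no  _   = inj₂ refl

  openF-status : ∀ s f i →
    (0ℚ < offer s i f × status (openF s f) i ≡ just f) ⊎
    (¬ 0ℚ < offer s i f × status (openF s f) i ≡ status s i)
  openF-status s f i with 0ℚ <? offer s i f
  ... | yes 0<o = inj₁ (0<o , refl)
  ... | no  0≮o = inj₂ (0≮o , refl)

  raise-α-active : ∀ s δ {i} → status s i ≡ nothing → α (raise s δ) i ≡ α s i + δ
  raise-α-active s δ eq rewrite eq = refl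

  raise-α-frozen : ∀ s δ {i g} → status s i ≡ just g → α (raise s δ) i ≡ α s i
  raise-α-frozen s δ eq rewrite eq = refl

  bid-connect : ∀ {s j g} → status s j ≡ nothing → α s j ≡ D j g → ∀ i → bid (connect s j g) i ≡ bid s i
  bid-connect {s} {j} {g} active αj≡ i with connect-status s j g i
  ... | inj₁ (refl , st) = trans (cong (λ st → bidOf st (α s i) i) st)
                                 (trans (sym αj≡) (cong (λ st → bidOf st (α s i) i) (sym active)))
  ... | inj₂ st = cong (λ st → bidOf st (α s i) i) st

  bid-openF : ∀ s f i → bid (openF s f) i ≡ bid s i - offer s i f
  bid-openF s f i with openF-status s f i
  ... | inj₁ (0<o , st) = begin
    bidOf (status (openF s f) i) (α s i) i ≡⟨ cong (λ st → bidOf st (α s i) i) st ⟩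
    D i f                                  ≡⟨ solve 2 (λ b d → d := b :- (b :- d)) refl (bid s i) (D i f) ⟩
    bid s i - (bid s i - D i f)            ≡⟨ cong (λ x → bid s i - x) (sym offer≡bid-D) ⟩
    bid s i - offer s i f                  ∎
    where
    open ≡-Reasoning
    offer≡bid-D : offer s i f ≡ bid s i - D i f
    offer≡bid-D = trans (offer≡ s i f) (0<0⊔p⇒0⊔p≡p (subst (0ℚ <_) (offer≡ s i f) 0<o))
  ... | inj₂ (0≮o , st) = begin
    bidOf (status (openF s f) i) (α s i) i ≡⟨ cong (λ st → bidOf st (α s i) i) st ⟩
    bid s i                                ≡⟨ solve 1 (λ b → b := b :- con 0ℚ) refl (bid s i) ⟩
    bid s i - 0ℚ                           ≡⟨ cong (λ x → bid s i - x) (sym offer≡0) ⟩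
    bid s i - offer s i f                  ∎
    where
    open ≡-Reasoning
    offer≡0 : offer s i f ≡ 0ℚ
    offer≡0 = trans (offer≡ s i f) (0≮0⊔p⇒0⊔p≡0 {bid s i - D i f} (λ 0<o → 0≮o (subst (0ℚ <_) (sym (offer≡ s i f)) 0<o)))

  not-frozen⇒active : ∀ s i → frozen s i ≡ false → status s i ≡ nothing
  not-frozen⇒active s i not-frozen with nothing-or-just (status s i)
  ... | inj₁ st       = st
  ... | inj₂ (_ , st) = case trans (sym (cong is-just st)) not-frozen of λ ()

  α-bid-raise : ∀ s δ i → α (raise s δ) i - bid (raise s δ) i ≡ α s i - bid s i
  α-bid-raise s δ i with status s i
  ... | nothing = trans (+-inverseʳ (α s i + δ)) (sym (+-inverseʳ (α s i)))
  ... | just _  = refl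

  record Progress (s s′ : JMSState n m) : Set where
    field
      stays-frozen : ∀ i → frozen s i ≡ true → frozen s′ i ≡ true
      frozen-α     : ∀ i → frozen s′ i ≡ true → α s′ i ≡ α s i
      opened-grows : opened s ⊆ opened s′

  step-progress : ∀ {s s′} → Step s s′ → Progress s s′
  step-progress {s} (connectStep j g _ _ _) = record
    { stays-frozen = stays
    ; frozen-α     = λ _ _ → refl
    ; opened-grows = λ g∈S → g∈S
    }
    where
    stays : ∀ i → frozen s i ≡ true → frozen (connect s j g) i ≡ true
    stays i fr with connect-status s j g i
    ... | inj₁ (_ , st) = cong is-just st
    ... | inj₂ st       = trans (cong is-just st) fr
  step-progress {s} (openStep f _ _) = record
    { stays-frozen = stays
    ; frozen-α     = λ _ _ → refl
    ; opened-grows = λ g∈S → x∈p∪q⁺ (inj₂ g∈S)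
    }
    where
    stays : ∀ i → frozen s i ≡ true → frozen (openF s f) i ≡ true
    stays i fr with openF-status s f i
    ... | inj₁ (_ , st) = cong is-just st
    ... | inj₂ (_ , st) = trans (cong is-just st) fr
  step-progress {s} (raiseStep δ _ _ _ _) = record
    { stays-frozen = λ _ fr → fr
    ; frozen-α     = frozen-α
    ; opened-grows = λ g∈S → g∈S
    }
    where
    frozen-α : ∀ i → frozen s i ≡ true → α (raise s δ) i ≡ α s i
    frozen-α i fr with nothing-or-just (status s i)
    ... | inj₁ st       = case trans (sym fr) (cong is-just st) of λ ()
    ... | inj₂ (_ , st) = raise-α-frozen s δ st

-- The run invariant

module RunInvariant {n m} (I : UFL n m) (oc : Fin m → ℚ) where
  open UFL I
  open JMS I oc
  open Mechanics I oc

  record Invariant (s : JMSState n m) : Set where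
    field
      served-open       : ∀ i {g} → status s i ≡ just g → g ∈ opened s
      active-below-open : ∀ i {g} → status s i ≡ nothing → g ∈ opened s → α s i ≤ D i g
      closed-unpaid     : ∀ {g} → g ∉ opened s → offers s g ≤ oc g
      active-equal      : ∀ i j → status s i ≡ nothing → status s j ≡ nothing → α s i ≡ α s j
      free-unreached    : ∀ i g → oc g ≡ 0ℚ → α s i ≤ D i g
      opening-paid      : ∑∈ (opened s) oc ≤ paid s
  open Invariant public

  invariant-init : (∀ g → 0ℚ ≤ oc g) → Invariant initState
  invariant-init oc≥0 = record
    { served-open       = λ _ ()
    ; active-below-open = λ _ _ g∈⊥ → ⊥-elim (∉⊥ g∈⊥)
    ; closed-unpaid     = λ {g} _ → ≤-trans (≤-reflexive (trans (∑-cong (λ j → 0⊔[0-D] j g)) (∑-zero n))) (oc≥0 g)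
    ; active-equal      = λ _ _ _ _ → refl
    ; free-unreached    = λ i g _ → dist-nonneg _ _
    ; opening-paid      = ≤-reflexive (trans (∑-cong (λ g → cong (λ b → if b then oc g else 0ℚ) (lookup-replicate g false)))
                                             (trans (∑-zero m) (sym (∑-zero n))))
    }
    where
    0⊔[0-D] : ∀ j g → 0ℚ ⊔ (0ℚ - D j g) ≡ 0ℚ
    0⊔[0-D] j g = p≥q⇒p⊔q≡p (p≤q+r⇒p-r≤q {r = D j g} (subst (0ℚ ≤_) (sym (+-identityˡ (D j g))) (dist-nonneg _ _)))

  module _ {s j g} (inv : Invariant s) (active : status s j ≡ nothing) (g∈S : g ∈ opened s)
           (αj≡ : α s j ≡ D j g) where
    private
      s′ = connect s j g

    active-connect : ∀ i → status s′ i ≡ nothing → status s i ≡ nothing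
    active-connect i st′ with connect-status s j g i
    ... | inj₁ (_ , st) = case trans (sym st) st′ of λ ()
    ... | inj₂ st = trans (sym st) st′

    offer-connect : ∀ i h → offer s′ i h ≡ offer s i h
    offer-connect i h = trans (offer≡ s′ i h)
      (trans (cong (λ b → 0ℚ ⊔ (b - D i h)) (bid-connect active αj≡ i)) (sym (offer≡ s i h)))

    invariant-connect : Invariant s′
    invariant-connect = record
      { served-open       = served
      ; active-below-open = λ i st′ → active-below-open inv i (active-connect i st′)
      ; closed-unpaid     = λ {h} h∉S → subst (_≤ oc h) (sym (∑-cong (λ i → offer-connect i h))) (closed-unpaid inv h∉S)
      ; active-equal      = λ i i′ st st′ → active-equal inv i i′ (active-connect i st) (active-connect i′ st′)
      ; free-unreached    = free-unreached inv
      ; opening-paid      = subst (∑∈ (opened s) oc ≤_)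
                                  (∑-cong (λ i → cong (λ b → α s i - b) (sym (bid-connect active αj≡ i))))
                                  (opening-paid inv)
      }
      where
      served : ∀ i {h} → status s′ i ≡ just h → h ∈ opened s
      served i st′ with connect-status s j g i
      ... | inj₁ (_ , st) with trans (sym st) st′
      ...   | refl = g∈S
      served i st′ | inj₂ st = served-open inv i (trans (sym st) st′)

  module _ {s f} (inv : Invariant s) (f∉S : f ∉ opened s) (oc≤offers : oc f ≤ offers s f) where
    private
      s′ = openF s f

    active-openF : ∀ i → status s′ i ≡ nothing → ¬ 0ℚ < offer s i f × status s i ≡ nothing
    active-openF i st′ with openF-status s f i
    ... | inj₁ (_ , st)   = case trans (sym st) st′ of λ ()
    ... | inj₂ (0≮o , st) = 0≮o , trans (sym st) st′

    offer-openF : ∀ i h → offer s′ i h ≤ offer s i h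
    offer-openF i h = subst₂ _≤_ (sym (offer≡ s′ i h)) (sym (offer≡ s i h))
      (⊔-monoʳ-≤ 0ℚ (+-monoˡ-≤ (- D i h) (subst (_≤ bid s i) (sym (bid-openF s f i))
        (p≤q+r⇒p-r≤q {bid s i} (p≤p+q (offer-nonNeg s i f))))))

    paid-openF : paid s′ ≡ paid s + offers s f
    paid-openF = trans (∑-cong step) (∑-distrib-+ (λ i → α s i - bid s i) (λ i → offer s i f))
      where
      step : ∀ i → α s i - bid s′ i ≡ (α s i - bid s i) + offer s i f
      step i = trans (cong (λ b → α s i - b) (bid-openF s f i))
        (solve 3 (λ a b o → a :- (b :- o) := (a :- b) :+ o) refl (α s i) (bid s i) (offer s i f))

    invariant-openF : Invariant s′
    invariant-openF = record
      { served-open       = served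
      ; active-below-open = below
      ; closed-unpaid     = λ {h} h∉S′ → ≤-trans (∑-mono (λ i → offer-openF i h))
                                           (closed-unpaid inv (λ h∈S → h∉S′ (x∈p∪q⁺ (inj₂ h∈S))))
      ; active-equal      = λ i i′ st st′ →
                              active-equal inv i i′ (proj₂ (active-openF i st)) (proj₂ (active-openF i′ st′))
      ; free-unreached    = free-unreached inv
      ; opening-paid      = begin
          ∑∈ (⁅ f ⁆ ∪ opened s) oc  ≡⟨ ∑∈-insert (opened s) oc f∉S ⟩
          oc f + ∑∈ (opened s) oc   ≤⟨ +-mono-≤ oc≤offers (opening-paid inv) ⟩
          offers s f + paid s       ≡⟨ +-comm (offers s f) (paid s) ⟩
          paid s + offers s f       ≡⟨ sym paid-openF ⟩
          paid s′                   ∎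
      }
      where
      open ≤-Reasoning
      served : ∀ i {h} → status s′ i ≡ just h → h ∈ ⁅ f ⁆ ∪ opened s
      served i st′ with openF-status s f i
      ... | inj₁ (_ , st) with trans (sym st) st′
      ...   | refl = x∈p∪q⁺ (inj₁ (x∈⁅x⁆ f))
      served i st′ | inj₂ (_ , st) = x∈p∪q⁺ (inj₂ (served-open inv i (trans (sym st) st′)))
      below : ∀ i {h} → status s′ i ≡ nothing → h ∈ ⁅ f ⁆ ∪ opened s → α s i ≤ D i h
      below i st′ h∈S′ with active-openF i st′ | x∈p∪q⁻ ⁅ f ⁆ (opened s) h∈S′
      ... | _ , st | inj₂ h∈S = active-below-open inv i st h∈S
      ... | 0≮o , st | inj₁ h∈f with x∈⁅y⁆⇒x≡y f h∈f
      ...   | refl = p-q≤0⇒p≤q (≤-trans (subst (λ b → b - D i f ≤ offer s i f) (cong (λ st → bidOf st (α s i) i) st)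
                                                  (bid-offer s i f))
                                        (≮⇒≥ 0≮o))

  module _ {s δ} (inv : Invariant s)
           (below-open : ∀ j g → status s j ≡ nothing → g ∈ opened s → α (raise s δ) j ≤ D j g)
           (below-cost : ∀ g → g ∉ opened s → offers (raise s δ) g ≤ oc g) where
    private
      s′ = raise s δ

    invariant-raise : Invariant s′
    invariant-raise = record
      { served-open       = served-open inv
      ; active-below-open = λ i → below-open i _
      ; closed-unpaid     = below-cost _
      ; active-equal      = λ i j st st′ → trans (raise-α-active s δ st)
                              (trans (cong (_+ δ) (active-equal inv i j st st′)) (sym (raise-α-active s δ st′)))
      ; free-unreached    = free
      ; opening-paid      = subst (∑∈ (opened s) oc ≤_) (sym (∑-cong (α-bid-raise s δ))) (opening-paid inv)
      }
      where
      free : ∀ i g → oc g ≡ 0ℚ → α s′ i ≤ D i g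
      free i g free-g with nothing-or-just (status s i) | g ∈? opened s
      ... | inj₂ (_ , st) | _       = subst (_≤ D i g) (sym (raise-α-frozen s δ st)) (free-unreached inv i g free-g)
      ... | inj₁ st       | yes g∈S = below-open i g st g∈S
      ... | inj₁ st       | no  g∉S = p-q≤0⇒p≤q (begin
        α s′ i - D i g  ≡⟨ cong (λ st → bidOf st (α s′ i) i - D i g) (sym st) ⟩
        bid s′ i - D i g ≤⟨ bid-offer s′ i g ⟩
        offer s′ i g    ≤⟨ offer≤offers s′ i g ⟩
        offers s′ g     ≤⟨ below-cost g g∉S ⟩
        oc g            ≡⟨ free-g ⟩
        0ℚ              ∎)
        where open ≤-Reasoning

  invariant-step : ∀ {s s′} → Step s s′ → Invariant s → Invariant s′
  invariant-step (connectStep j g active g∈S αj≡) inv  = invariant-connect inv active g∈S αj≡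
  invariant-step (openStep f f∉S oc≤offers) inv        = invariant-openF inv f∉S oc≤offers
  invariant-step (raiseStep δ _ _ below-open below-cost) inv = invariant-raise inv below-open below-cost

  invariant-run : ∀ {s s′} → Star ActiveStep s s′ → Invariant s → Invariant s′
  invariant-run ε                 inv = inv
  invariant-run ((_ , step) ◅ run) inv = invariant-run run (invariant-step step inv)

  -- Lower bounds on the offers an active client i sees: a connected j is served by an open facility,
  -- which i has not passed, so by the triangle inequality through h it is not far from j either.
  offer-from-active : ∀ {s i j} h → Invariant s → status s i ≡ nothing → status s j ≡ nothing →
                      α s i ≤ offer s j h + D j h
  offer-from-active {s} {i} {j} h inv active-i active-j = p-r≤q⇒p≤q+r (subst (λ a → a - D j h ≤ offer s j h)
    (trans (cong (λ st → bidOf st (α s j) j) active-j) (active-equal inv j i active-j active-i)) (bid-offer s j h))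

  offer-from-connected : ∀ {s i j g} h → Invariant s → status s i ≡ nothing → status s j ≡ just g →
                         α s i ≤ offer s j h + (D i h + 2ℚ * D j h)
  offer-from-connected {s} {i} {j} {g} h inv active-i served-j = begin
    α s i                                   ≤⟨ active-below-open inv i active-i (served-open inv j served-j) ⟩
    D i g                                   ≤⟨ dcf-detour I i j h g ⟩
    D i h + (D j h + D j g)                 ≤⟨ +-monoʳ-≤ (D i h) (+-monoʳ-≤ (D j h) Djg≤) ⟩
    D i h + (D j h + (offer s j h + D j h)) ≡⟨ solve 3 (λ a b o → a :+ (b :+ (o :+ b)) := o :+ (a :+ con 2ℚ :* b))
                                                     refl (D i h) (D j h) (offer s j h) ⟩
    offer s j h + (D i h + 2ℚ * D j h)     ∎
    where
    open ≤-Reasoning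
    Djg≤ : D j g ≤ offer s j h + D j h
    Djg≤ = p-r≤q⇒p≤q+r (subst (λ b → b - D j h ≤ offer s j h) (cong (λ st → bidOf st (α s j) j) served-j)
                                (bid-offer s j h))

  paid-for : ∀ {s} → Invariant s → Terminal s → ∑∈ (opened s) oc + d I (opened s) ≤ ∑ (α s)
  paid-for {s} inv terminal = begin
    ∑∈ (opened s) oc + d I (opened s)  ≤⟨ +-mono-≤ (opening-paid inv) (∑-mono connection≤bid) ⟩
    paid s + ∑ (bid s)                 ≡⟨ sym (∑-distrib-+ (λ j → α s j - bid s j) (bid s)) ⟩
    ∑ (λ j → α s j - bid s j + bid s j) ≡⟨ ∑-cong (λ j → solve 2 (λ a b → a :- b :+ b := a) refl (α s j) (bid s j)) ⟩
    ∑ (α s)                            ∎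
    where
    open ≤-Reasoning
    connection≤bid : ∀ j → closest I j (opened s) ≤ bid s j
    connection≤bid j with terminal j
    ... | g , st = subst (closest I j (opened s) ≤_) (cong (λ st → bidOf st (α s j) j) (sym st))
                         (closest-≤ I j (served-open inv j st))

-- The star inequality

closedBound : ℚ → ℚ → ℚ → ℚ → ℚ
closedBound N c A B = N * c + (2ℚ * N - 1ℚ) * A + N * B

closedBound-grow : ∀ N p c A δ B →
  closedBound N c A (B + δ) + ((c + 2ℚ * A + (B + δ)) * p + N * δ) + (p * δ - δ) ≡
  closedBound (N + p) c (A + δ) B
closedBound-grow = solve 6 (λ N p c A δ B →
  (N :* c :+ (con 2ℚ :* N :- con 1ℚ) :* A :+ N :* (B :+ δ)) :+ ((c :+ con 2ℚ :* A :+ (B :+ δ)) :* p :+ N :* δ) :+ (p :* δ :- δ)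
  := (N :+ p) :* c :+ (con 2ℚ :* (N :+ p) :- con 1ℚ) :* (A :+ δ) :+ (N :+ p) :* B) refl

closedBound+kB≤ : ∀ {N k c A B} → N ≤ k → 0ℚ ≤ c → 0ℚ ≤ A → 0ℚ ≤ B →
                  closedBound N c A B + k * B ≤ k * (c + 2ℚ * (A + B))
closedBound+kB≤ {N} {k} {c} {A} {B} N≤k 0≤c 0≤A 0≤B =
  subst (closedBound N c A B + k * B ≤_) slack-eq (p≤p+q 0≤slack)
  where
  0≤k-N = p≤q⇒0≤q-p N≤k
  0≤slack : 0ℚ ≤ (k - N) * c + (2ℚ * (k - N) + 1ℚ) * A + (k - N) * B
  0≤slack = +-mono-≤ (+-mono-≤ (*-nonNeg 0≤k-N 0≤c)
                               (*-nonNeg (+-mono-≤ (*-nonNeg 0≤2 0≤k-N) (nonNegative⁻¹ 1ℚ)) 0≤A))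
                     (*-nonNeg 0≤k-N 0≤B)
  slack-eq : closedBound N c A B + k * B + ((k - N) * c + (2ℚ * (k - N) + 1ℚ) * A + (k - N) * B) ≡
             k * (c + 2ℚ * (A + B))
  slack-eq = solve 5 (λ N k c A B →
    N :* c :+ (con 2ℚ :* N :- con 1ℚ) :* A :+ N :* B :+ k :* B :+ ((k :- N) :* c :+ (con 2ℚ :* (k :- N) :+ con 1ℚ) :* A :+ (k :- N) :* B)
    := k :* (c :+ con 2ℚ :* (A :+ B))) refl N k c A B

module FacilityStar {n m} (I : UFL n m) (oc : Fin m → ℚ) (oc≥0 : ∀ g → 0ℚ ≤ oc g) (f : Fin m) (T : Fin n → Bool) where
  open UFL I
  open JMS I oc
  open Mechanics I oc
  open RunInvariant I oc

  dist-f : Fin n → ℚ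
  dist-f i = D i f

  one : Fin n → ℚ
  one _ = 1ℚ

  ∑T : (Fin n → ℚ) → ℚ
  ∑T w = ∑ (λ i → 𝟙 (T i) * w i)

  frozenIn activeIn : JMSState n m → Fin n → Bool
  frozenIn s i = T i ∧ frozen s i
  activeIn s i = T i ∧ not (frozen s i)

  ∑frozen ∑active : JMSState n m → (Fin n → ℚ) → ℚ
  ∑frozen s w = ∑ (λ i → 𝟙 (frozenIn s i) * w i)
  ∑active s w = ∑ (λ i → 𝟙 (activeIn s i) * w i)

  k : ℚ
  k = ∑T one

  -- While f is closed, every client of T that gets connected satisfies active-bound, and
  -- closedBound absorbs these bounds one step at a time (closedBound-grow). Once f is open, clients
  -- connect with α ≤ dist(·,f), and that is paid for by the term k ∑active.
  record StarInvariant (s : JMSState n m) : Set where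
    field
      while-closed : f ∉ opened s →
        k * ∑frozen s (α s) ≤ closedBound (∑frozen s one) (oc f) (∑frozen s dist-f) (∑active s dist-f)
      once-open    : f ∈ opened s →
        k * ∑frozen s (α s) + k * ∑active s dist-f ≤ k * (oc f + 2ℚ * ∑T dist-f)
  open StarInvariant

  ∑frozen-nonNeg : ∀ s {w} → (∀ i → 0ℚ ≤ w i) → 0ℚ ≤ ∑frozen s w
  ∑frozen-nonNeg s 0≤w = ∑-nonNeg (λ i → *-nonNeg (𝟙-nonNeg (frozenIn s i)) (0≤w i))

  ∑active-nonNeg : ∀ s {w} → (∀ i → 0ℚ ≤ w i) → 0ℚ ≤ ∑active s w
  ∑active-nonNeg s 0≤w = ∑-nonNeg (λ i → *-nonNeg (𝟙-nonNeg (activeIn s i)) (0≤w i))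

  ∑frozen+∑active : ∀ s w → ∑frozen s w + ∑active s w ≡ ∑T w
  ∑frozen+∑active s w =
    trans (sym (∑-distrib-+ (λ i → 𝟙 (frozenIn s i) * w i) (λ i → 𝟙 (activeIn s i) * w i))) (∑-cong λ i →
    trans (sym (*-distribʳ-+ (w i) (𝟙 (frozenIn s i)) (𝟙 (activeIn s i))))
          (cong (_* w i) (𝟙-partition (T i) (frozen s i))))

  dist-f-nonNeg : ∀ i → 0ℚ ≤ dist-f i
  dist-f-nonNeg i = dist-nonneg _ _

  closed⇒open-bound : ∀ {s} →
    k * ∑frozen s (α s) ≤ closedBound (∑frozen s one) (oc f) (∑frozen s dist-f) (∑active s dist-f) →
    k * ∑frozen s (α s) + k * ∑active s dist-f ≤ k * (oc f + 2ℚ * ∑T dist-f)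
  closed⇒open-bound {s} bound = ≤-trans (+-monoˡ-≤ (k * ∑active s dist-f) bound)
    (subst (λ x → closedBound N c A B + k * B ≤ k * (c + 2ℚ * x)) (∑frozen+∑active s dist-f)
      (closedBound+kB≤ N≤k (oc≥0 f) (∑frozen-nonNeg s dist-f-nonNeg) (∑active-nonNeg s dist-f-nonNeg)))
    where
    N = ∑frozen s one
    c = oc f
    A = ∑frozen s dist-f
    B = ∑active s dist-f
    N≤k : N ≤ k
    N≤k = subst (∑frozen s one ≤_) (∑frozen+∑active s one)
                (p≤p+q (∑active-nonNeg s (λ _ → nonNegative⁻¹ 1ℚ)))

  -- The JMS inequality: the offers of T to the closed f, bounded below as in offer-from-active and
  -- offer-from-connected, add up to at most oc f.
  active-bound : ∀ {s i} → Invariant s → f ∉ opened s → status s i ≡ nothing →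
    k * α s i ≤ oc f + ∑frozen s one * dist-f i + 2ℚ * ∑frozen s dist-f + ∑active s dist-f
  active-bound {s} {i} inv f∉S active = begin
    k * α s i
      ≡⟨ trans (*-comm k (α s i)) (*-distribˡ-∑ (α s i) (λ j → 𝟙 (T j) * 1ℚ)) ⟩
    ∑ (λ j → α s i * (𝟙 (T j) * 1ℚ))
      ≤⟨ ∑-mono pointwise ⟩
    ∑ (λ j → offer s j f + 𝟙 (frozenIn s j) * (dist-f i * 1ℚ + 2ℚ * dist-f j) + 𝟙 (activeIn s j) * dist-f j)
      ≡⟨ trans (∑-distrib-+ _ (λ j → 𝟙 (activeIn s j) * dist-f j))
               (cong (_+ ∑active s dist-f) (trans (∑-distrib-+ (λ j → offer s j f) _)
                 (cong (offers s f +_) (∑-linear (λ j → 𝟙 (frozenIn s j)) one dist-f (dist-f i) 2ℚ)))) ⟩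
    offers s f + (dist-f i * ∑frozen s one + 2ℚ * ∑frozen s dist-f) + ∑active s dist-f
      ≤⟨ +-monoˡ-≤ (∑active s dist-f) (+-monoˡ-≤ _ (closed-unpaid inv f∉S)) ⟩
    oc f + (dist-f i * ∑frozen s one + 2ℚ * ∑frozen s dist-f) + ∑active s dist-f
      ≡⟨ solve 5 (λ c d N A B → c :+ (d :* N :+ con 2ℚ :* A) :+ B := c :+ N :* d :+ con 2ℚ :* A :+ B)
               refl (oc f) (dist-f i) (∑frozen s one) (∑frozen s dist-f) (∑active s dist-f) ⟩
    oc f + ∑frozen s one * dist-f i + 2ℚ * ∑frozen s dist-f + ∑active s dist-f ∎
    where
    open ≤-Reasoning
    pointwise : ∀ j → α s i * (𝟙 (T j) * 1ℚ) ≤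
      offer s j f + 𝟙 (frozenIn s j) * (dist-f i * 1ℚ + 2ℚ * dist-f j) + 𝟙 (activeIn s j) * dist-f j
    pointwise j = subst (_≤ offer s j f + 𝟙 (frozenIn s j) * (dist-f i * 1ℚ + 2ℚ * dist-f j) + 𝟙 (activeIn s j) * dist-f j)
      (solve 2 (λ t a → t :* a := a :* (t :* con 1ℚ)) refl (𝟙 (T j)) (α s i))
      (𝟙-case-bound (T j) (frozen s j) (offer-nonNeg s j f) via-connected via-active)
      where
      via-connected : frozen s j ≡ true → α s i ≤ offer s j f + (dist-f i * 1ℚ + 2ℚ * dist-f j)
      via-connected fr with nothing-or-just (status s j)
      ... | inj₁ st       = case trans (sym fr) (cong is-just st) of λ ()
      ... | inj₂ (_ , st) = subst (λ x → α s i ≤ offer s j f + (x + 2ℚ * dist-f j)) (sym (*-identityʳ (dist-f i)))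
                                  (offer-from-connected f inv active st)
      via-active : frozen s j ≡ false → α s i ≤ offer s j f + dist-f j
      via-active not-frozen = offer-from-active f inv active (not-frozen⇒active s j not-frozen)

  module _ {s s′} (inv : Invariant s) (prog : Progress s s′) (star : StarInvariant s) where
    open Progress prog

    newIn : Fin n → Bool
    newIn i = T i ∧ newly (frozen s i) (frozen s′ i)

    ∑new : (Fin n → ℚ) → ℚ
    ∑new w = ∑ (λ i → 𝟙 (newIn i) * w i)

    ∑frozen-step : ∀ {w w′} → (∀ i → frozen s′ i ≡ true → w′ i ≡ w i) → ∑frozen s′ w′ ≡ ∑frozen s w + ∑new w
    ∑frozen-step {w} {w′} w′≡w = trans (∑-cong split) (∑-distrib-+ (λ i → 𝟙 (frozenIn s i) * w i) (λ i → 𝟙 (newIn i) * w i))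
      where
      split : ∀ i → 𝟙 (frozenIn s′ i) * w′ i ≡ 𝟙 (frozenIn s i) * w i + 𝟙 (newIn i) * w i
      split i = trans (𝟙*-cong (frozenIn s′ i) (λ fr → w′≡w i (∧-conicalʳ (T i) (frozen s′ i) fr)))
        (trans (cong (_* w i) (𝟙-split-new (T i) (frozen s i) (frozen s′ i) (stays-frozen i)))
               (*-distribʳ-+ (w i) (𝟙 (frozenIn s i)) (𝟙 (newIn i))))

    ∑active-step : ∀ w → ∑active s w ≡ ∑active s′ w + ∑new w
    ∑active-step w = trans (∑-cong split) (∑-distrib-+ (λ i → 𝟙 (activeIn s′ i) * w i) (λ i → 𝟙 (newIn i) * w i))
      where
      split : ∀ i → 𝟙 (activeIn s i) * w i ≡ 𝟙 (activeIn s′ i) * w i + 𝟙 (newIn i) * w i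
      split i = trans (cong (_* w i) (𝟙-split-new-not (T i) (frozen s i) (frozen s′ i) (stays-frozen i)))
                      (*-distribʳ-+ (w i) (𝟙 (activeIn s′ i)) (𝟙 (newIn i)))

    new-active : ∀ i → newIn i ≡ true → status s i ≡ nothing
    new-active i new = not-frozen⇒active s i
      (newly⇒false-before (frozen s i) (frozen s′ i) (∧-conicalʳ (T i) _ new))

    k*∑frozen-step : k * ∑frozen s′ (α s′) ≡ k * ∑frozen s (α s) + k * ∑new (α s)
    k*∑frozen-step = trans (cong (k *_) (∑frozen-step frozen-α)) (*-distribˡ-+ k _ _)

    while-closed-step : f ∉ opened s →
      k * ∑frozen s′ (α s′) ≤ closedBound (∑frozen s′ one) (oc f) (∑frozen s′ dist-f) (∑active s′ dist-f)
    while-closed-step f∉S = begin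
      k * ∑frozen s′ (α s′)                    ≡⟨ k*∑frozen-step ⟩
      k * ∑frozen s (α s) + k * ∑new (α s)     ≤⟨ +-mono-≤ (while-closed star f∉S) new-bound ⟩
      closedBound N c A B + (X * p + N * δ)    ≤⟨ p≤p+q (p≤q⇒0≤q-p δ≤pδ) ⟩
      closedBound N c A B + (X * p + N * δ) + (p * δ - δ)
        ≡⟨ cong (λ b → closedBound N c A b + ((c + 2ℚ * A + b) * p + N * δ) + (p * δ - δ)) (∑active-step dist-f) ⟩
      closedBound N c A (B′ + δ) + ((c + 2ℚ * A + (B′ + δ)) * p + N * δ) + (p * δ - δ)
        ≡⟨ closedBound-grow N p c A δ B′ ⟩
      closedBound (N + p) c (A + δ) B′
        ≡⟨ sym (cong₂ (λ N′ A′ → closedBound N′ c A′ B′) (∑frozen-step (λ _ _ → refl)) (∑frozen-step (λ _ _ → refl))) ⟩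
      closedBound (∑frozen s′ one) c (∑frozen s′ dist-f) B′ ∎
      where
      open ≤-Reasoning
      N = ∑frozen s one
      c = oc f
      A = ∑frozen s dist-f
      B = ∑active s dist-f
      B′ = ∑active s′ dist-f
      X = c + 2ℚ * A + B
      p = ∑new one
      δ = ∑new dist-f
      regroup : ∀ d → c + N * d + 2ℚ * A + B ≡ X * 1ℚ + N * d
      regroup = solve 5 (λ c N A B d → c :+ N :* d :+ con 2ℚ :* A :+ B := (c :+ con 2ℚ :* A :+ B) :* con 1ℚ :+ N :* d)
                        refl c N A B
      new-bound : k * ∑new (α s) ≤ X * p + N * δ
      new-bound = begin
        k * ∑new (α s)                                 ≡⟨ ∑-scale k (λ i → 𝟙 (newIn i)) (α s) ⟩
        ∑ (λ i → 𝟙 (newIn i) * (k * α s i))            ≤⟨ ∑-mono (λ i → 𝟙*-mono (newIn i) λ new →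
                                                            subst (k * α s i ≤_) (regroup (dist-f i))
                                                              (active-bound inv f∉S (new-active i new))) ⟩
        ∑ (λ i → 𝟙 (newIn i) * (X * 1ℚ + N * dist-f i)) ≡⟨ ∑-linear (λ i → 𝟙 (newIn i)) one dist-f X N ⟩
        X * p + N * δ ∎
      δ≤pδ : δ ≤ p * δ
      δ≤pδ = ≤-trans (∑-mono (λ i → 𝟙*-mono (newIn i) (λ new → d≤pd i new)))
                     (≤-reflexive (sym (∑-scale p (λ i → 𝟙 (newIn i)) dist-f)))
        where
        d≤pd : ∀ i → newIn i ≡ true → dist-f i ≤ p * dist-f i
        d≤pd i new = subst (_≤ p * dist-f i) (*-identityˡ (dist-f i))
          (*-monoʳ-≤-nonNeg (dist-f i) {{nonNegative (dist-f-nonNeg i)}}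
            (subst (_≤ p) (trans (cong (λ b → 𝟙 b * 1ℚ) new) (*-identityˡ 1ℚ))
              (term≤∑ (λ j → *-nonNeg (𝟙-nonNeg (newIn j)) (nonNegative⁻¹ 1ℚ)) i)))

    once-open-step : f ∈ opened s →
      k * ∑frozen s′ (α s′) + k * ∑active s′ dist-f ≤ k * (oc f + 2ℚ * ∑T dist-f)
    once-open-step f∈S = begin
      k * ∑frozen s′ (α s′) + k * B′                  ≡⟨ cong (_+ k * B′) k*∑frozen-step ⟩
      k * ∑frozen s (α s) + k * ∑new (α s) + k * B′   ≤⟨ +-monoˡ-≤ (k * B′) (+-monoʳ-≤ (k * ∑frozen s (α s)) new-bound) ⟩
      k * ∑frozen s (α s) + k * δ + k * B′
        ≡⟨ solve 4 (λ L k δ B → L :+ k :* δ :+ k :* B := L :+ k :* (B :+ δ)) refl (k * ∑frozen s (α s)) k δ B′ ⟩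
      k * ∑frozen s (α s) + k * (B′ + δ)              ≡⟨ cong (λ b → k * ∑frozen s (α s) + k * b) (sym (∑active-step dist-f)) ⟩
      k * ∑frozen s (α s) + k * ∑active s dist-f      ≤⟨ once-open star f∈S ⟩
      k * (oc f + 2ℚ * ∑T dist-f)                     ∎
      where
      open ≤-Reasoning
      B′ = ∑active s′ dist-f
      δ = ∑new dist-f
      new-bound : k * ∑new (α s) ≤ k * δ
      new-bound = *-monoˡ-≤-nonNeg k {{nonNegative (∑-nonNeg (λ i → *-nonNeg (𝟙-nonNeg (T i)) (nonNegative⁻¹ 1ℚ)))}}
        (∑-mono (λ i → 𝟙*-mono (newIn i) (λ new → active-below-open inv i (new-active i new) f∈S)))

    star-step : StarInvariant s′
    star-step = record
      { while-closed = λ f∉S′ → while-closed-step (λ f∈S → f∉S′ (opened-grows f∈S))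
      ; once-open    = once-open′
      }
      where
      once-open′ : f ∈ opened s′ → k * ∑frozen s′ (α s′) + k * ∑active s′ dist-f ≤ k * (oc f + 2ℚ * ∑T dist-f)
      once-open′ _ with f ∈? opened s
      ... | yes f∈S = once-open-step f∈S
      ... | no  f∉S = closed⇒open-bound {s′} (while-closed-step f∉S)

  star-init : StarInvariant initState
  star-init = record
    { while-closed = λ _ → ≤-reflexive
        (trans (trans (cong (k *_) (∑frozen-init (α (initState {n} {m})))) (*-zeroʳ k)) (sym bound≡0))
    ; once-open    = λ f∈⊥ → ⊥-elim (∉⊥ f∈⊥)
    }
    where
    B₀ : ℚ
    B₀ = ∑active initState dist-f
    ∑frozen-init : ∀ w → ∑frozen initState w ≡ 0ℚ
    ∑frozen-init w = trans (∑-cong (λ i → trans (cong (λ b → 𝟙 b * w i) (∧-zeroʳ (T i))) (*-zeroˡ (w i)))) (∑-zero n)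
    bound≡0 : closedBound (∑frozen initState one) (oc f) (∑frozen initState dist-f) B₀ ≡ 0ℚ
    bound≡0 = trans (cong₂ (λ N A → closedBound N (oc f) A B₀) (∑frozen-init one) (∑frozen-init dist-f))
      (solve 2 (λ c B → con 0ℚ :* c :+ (con 2ℚ :* con 0ℚ :- con 1ℚ) :* con 0ℚ :+ con 0ℚ :* B := con 0ℚ) refl (oc f) B₀)

  star-run : ∀ {s s′} → Star ActiveStep s s′ → Invariant s → StarInvariant s → StarInvariant s′
  star-run ε                 _   star = star
  star-run ((_ , step) ◅ run) inv star =
    star-run run (invariant-step step inv) (star-step inv (step-progress step) star)

  scaled-star-bound : ∀ {s} → StarInvariant s →
    k * ∑frozen s (α s) + k * ∑active s dist-f ≤ k * (oc f + 2ℚ * ∑T dist-f)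
  scaled-star-bound {s} star with f ∈? opened s
  ... | yes f∈S = once-open star f∈S
  ... | no  f∉S = closed⇒open-bound {s} (while-closed star f∉S)

  module _ {s} (all-frozen : ∀ i → frozen s i ≡ true) where
    ∑frozen-all : ∀ w → ∑frozen s w ≡ ∑T w
    ∑frozen-all w = ∑-cong (λ j → cong (λ b → 𝟙 b * w j) (trans (cong (T j ∧_) (all-frozen j)) (∧-identityʳ (T j))))

    ∑active-none : ∀ w → ∑active s w ≡ 0ℚ
    ∑active-none w = trans (∑-cong (λ j → trans (cong (λ b → 𝟙 (T j ∧ not b) * w j) (all-frozen j))
                                            (trans (cong (λ b → 𝟙 b * w j) (∧-zeroʳ (T j))) (*-zeroˡ (w j)))))
                           (∑-zero n)

  ∑T-empty : (∀ i → T i ≡ false) → ∀ w → ∑T w ≡ 0ℚ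
  ∑T-empty T-false w = trans (∑-cong (λ j → trans (cong (λ b → 𝟙 b * w j) (T-false j)) (*-zeroˡ (w j)))) (∑-zero n)

  k-pos : ∀ i → T i ≡ true → 0ℚ < k
  k-pos i Ti = <-≤-trans (positive⁻¹ 1ℚ) (subst (_≤ k) (trans (cong (λ b → 𝟙 b * 1ℚ) Ti) (*-identityˡ 1ℚ))
                                                (term≤∑ (λ j → *-nonNeg (𝟙-nonNeg (T j)) (nonNegative⁻¹ 1ℚ)) i))

  star-bound : ∀ {s} → StarInvariant s → (∀ i → frozen s i ≡ true) → ∑T (α s) ≤ oc f + 2ℚ * ∑T dist-f
  star-bound {s} star all-frozen with any? (λ i → T i ≟ᵇ true)
  ... | yes (i , Ti) = *-cancelˡ-≤-pos k {{positive (k-pos i Ti)}} (begin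
    k * ∑T (α s)                                ≡⟨ solve 2 (λ k A → k :* A := k :* A :+ k :* con 0ℚ) refl k (∑T (α s)) ⟩
    k * ∑T (α s) + k * 0ℚ                       ≡⟨ sym (cong₂ (λ A B → k * A + k * B) (∑frozen-all {s} all-frozen (α s))
                                                                                        (∑active-none {s} all-frozen dist-f)) ⟩
    k * ∑frozen s (α s) + k * ∑active s dist-f  ≤⟨ scaled-star-bound star ⟩
    k * (oc f + 2ℚ * ∑T dist-f)                 ∎)
    where open ≤-Reasoning
  ... | no  ∄T = begin
    ∑T (α s)               ≡⟨ ∑T-empty T-false (α s) ⟩
    0ℚ                     ≡⟨ sym (+-identityʳ 0ℚ) ⟩
    0ℚ + 0ℚ                ≤⟨ +-mono-≤ (oc≥0 f) (*-nonNeg 0≤2 (∑-nonNeg (λ j → *-nonNeg (𝟙-nonNeg (T j)) (dist-f-nonNeg j)))) ⟩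
    oc f + 2ℚ * ∑T dist-f  ∎
    where
    open ≤-Reasoning
    T-false : ∀ j → T j ≡ false
    T-false j with T j in Tj
    ... | true  = ⊥-elim (∄T (j , Tj))
    ... | false = refl

-- Extend-JMS

∑-by-fibres : ∀ {n m} (μ : Fin n → Fin m) (w : Fin n → ℚ) →
              ∑ w ≡ ∑ (λ g → ∑ (λ i → 𝟙 ⌊ μ i ≟ g ⌋ * w i))
∑-by-fibres μ w = trans
  (∑-cong (λ i → sym (trans (∑-cong (λ g → sym (if-then-0≡𝟙* ⌊ μ i ≟ g ⌋ (w i)))) (∑-δ (μ i) (w i)))))
  (∑-comm (λ i g → 𝟙 ⌊ μ i ≟ g ⌋ * w i))

module ExtendJMS {n m} (I : UFL n m) (S₀ : Subset m) where
  open UFL I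
  open JMS I (extCost I S₀)
  open Mechanics I (extCost I S₀)
  open RunInvariant I (extCost I S₀)

  extCost-nonNeg : ∀ g → 0ℚ ≤ extCost I S₀ g
  extCost-nonNeg g with lookup S₀ g
  ... | true  = ≤-refl
  ... | false = cost-nonneg g

  o≤extCost+o : ∀ S → o I S ≤ ∑∈ S (extCost I S₀) + o I S₀
  o≤extCost+o S = ≤-trans (∑-mono pointwise)
    (≤-reflexive (∑-distrib-+ (λ g → if lookup S g then extCost I S₀ g else 0ℚ) (λ g → if lookup S₀ g then cost g else 0ℚ)))
    where
    pointwise : ∀ g → (if lookup S g then cost g else 0ℚ) ≤
                      (if lookup S g then extCost I S₀ g else 0ℚ) + (if lookup S₀ g then cost g else 0ℚ)
    pointwise g with lookup S g | lookup S₀ g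
    ... | true  | true  = ≤-reflexive (sym (+-identityˡ (cost g)))
    ... | true  | false = ≤-reflexive (sym (+-identityʳ (cost g)))
    ... | false | true  = subst (0ℚ ≤_) (sym (+-identityˡ (cost g))) (cost-nonneg g)
    ... | false | false = ≤-refl

  charge : JMSState n m → (Fin n → Fin m) → Fin m → ℚ
  charge s μ g = ∑ (λ i → 𝟙 ⌊ μ i ≟ g ⌋ * α s i)

  assignedCost≡ : ∀ μ g → assignedCost I μ g ≡ ∑ (λ i → 𝟙 ⌊ μ i ≟ g ⌋ * dcf I i g)
  assignedCost≡ μ g = ∑-cong (λ i → if-then-0≡𝟙* ⌊ μ i ≟ g ⌋ (dcf I i g))

  charge-unassigned : ∀ s μ {g} → (∀ i → μ i ≢ g) → charge s μ g ≡ 0ℚ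
  charge-unassigned s μ {g} μ≢g =
    trans (∑-cong λ i → trans (cong (λ b → 𝟙 b * α s i) (unassigned i)) (*-zeroˡ (α s i))) (∑-zero n)
    where
    unassigned : ∀ i → ⌊ μ i ≟ g ⌋ ≡ false
    unassigned i with μ i ≟ g
    ... | yes μi≡g = ⊥-elim (μ≢g i μi≡g)
    ... | no  _    = refl

  charge-free : ∀ {s} μ {g} → Invariant s → g ∈ S₀ → charge s μ g ≤ assignedCost I μ g
  charge-free {s} μ {g} inv g∈S₀ = subst (charge s μ g ≤_) (sym (assignedCost≡ μ g))
    (∑-mono (λ i → 𝟙*-mono ⌊ μ i ≟ g ⌋ (λ _ → free-unreached inv i g free)))
    where
    free : extCost I S₀ g ≡ 0ℚ
    free = cong (λ b → if b then 0ℚ else cost g) ([]=⇒lookup g∈S₀)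

  charge-star : ∀ {s} μ g → Star ActiveStep initState s → Terminal s →
                charge s μ g ≤ extCost I S₀ g + 2ℚ * assignedCost I μ g
  charge-star {s} μ g run terminal = subst (λ ac → charge s μ g ≤ extCost I S₀ g + 2ℚ * ac) (sym (assignedCost≡ μ g))
    (star-bound (star-run run (invariant-init extCost-nonNeg) star-init) (λ i → cong is-just (proj₂ (terminal i))))
    where open FacilityStar I (extCost I S₀) extCost-nonNeg g (λ i → ⌊ μ i ≟ g ⌋)

  assignedCost-nonNeg : ∀ μ g → 0ℚ ≤ assignedCost I μ g
  assignedCost-nonNeg μ g = subst (0ℚ ≤_) (sym (assignedCost≡ μ g))
    (∑-nonNeg (λ i → *-nonNeg (𝟙-nonNeg ⌊ μ i ≟ g ⌋) (dist-nonneg _ _)))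

  facility-charge : ∀ {s S*} μ → S₀ ⊆ S* → (∀ i → μ i ∈ S*) → Star ActiveStep initState s → Terminal s → ∀ g →
    charge s μ g + (if lookup S₀ g then cost g else 0ℚ) ≤
    (if lookup S* g then cost g else 0ℚ) + (if lookup S₀ g then assignedCost I μ g else 0ℚ)
      + 2ℚ * (if lookup (S* ─ S₀) g then assignedCost I μ g else 0ℚ)
  facility-charge {s} {S*} μ S₀⊆S* μ∈S* run terminal g with g ∈? S₀ | g ∈? S*
  ... | yes g∈S₀ | _
    rewrite []=⇒lookup g∈S₀ | []=⇒lookup (S₀⊆S* g∈S₀) = begin
      charge s μ g + cost g  ≤⟨ +-monoˡ-≤ (cost g) (charge-free μ inv g∈S₀) ⟩
      AC + cost g            ≡⟨ +-comm AC (cost g) ⟩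
      cost g + AC            ≤⟨ p≤p+q (*-nonNeg 0≤2 (if-nonNeg (lookup (S* ─ S₀) g) (assignedCost-nonNeg μ g))) ⟩
      cost g + AC + 2ℚ * (if lookup (S* ─ S₀) g then AC else 0ℚ) ∎
    where
    open ≤-Reasoning
    AC = assignedCost I μ g
    inv = invariant-run run (invariant-init extCost-nonNeg)
  ... | no g∉S₀ | yes g∈S*
    rewrite lookup-∉ g∉S₀ | []=⇒lookup g∈S* | []=⇒lookup (x∈p∧x∉q⇒x∈p─q g∈S* g∉S₀) =
      subst₂ _≤_ (sym (+-identityʳ (charge s μ g))) (cong (_+ 2ℚ * assignedCost I μ g) (sym (+-identityʳ (cost g))))
        (subst (λ c → charge s μ g ≤ c + 2ℚ * assignedCost I μ g) extCost≡cost (charge-star μ g run terminal))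
    where
    extCost≡cost : extCost I S₀ g ≡ cost g
    extCost≡cost = cong (λ b → if b then 0ℚ else cost g) (lookup-∉ g∉S₀)
  ... | no g∉S₀ | no g∉S*
    rewrite lookup-∉ g∉S₀ | lookup-∉ g∉S* = begin
      charge s μ g + 0ℚ   ≡⟨ trans (+-identityʳ (charge s μ g)) (charge-unassigned s μ unassigned) ⟩
      0ℚ                  ≤⟨ *-nonNeg 0≤2 (if-nonNeg (lookup (S* ─ S₀) g) (assignedCost-nonNeg μ g)) ⟩
      2ℚ * X              ≡⟨ sym (+-identityˡ (2ℚ * X)) ⟩
      0ℚ + 0ℚ + 2ℚ * X    ∎
    where
    open ≤-Reasoning
    X = if lookup (S* ─ S₀) g then assignedCost I μ g else 0ℚ
    unassigned : ∀ i → μ i ≢ g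
    unassigned i μi≡g = g∉S* (subst (_∈ S*) μi≡g (μ∈S* i))

lemmaG6 : ∀ {n m} (I : UFL n m) (S₀ S* : Subset m) → S₀ ⊆ S* →
          (μ : Fin n → Fin m) → (∀ c → μ c ∈ S*) →
          (S'' : Subset m) → ExtendJMSOutput I S₀ S'' →
          o I S'' + d I S'' ≤
            o I S* + ∑∈ S₀ (assignedCost I μ)
                   + 2ℚ * ∑∈ (S* ─ S₀) (assignedCost I μ)
lemmaG6 {n} {m} I S₀ S* S₀⊆S* μ μ∈S* .(opened s) (s , run , terminal , refl) = begin
  o I S + d I S                           ≤⟨ +-monoˡ-≤ (d I S) (o≤extCost+o S) ⟩
  ∑∈ S oc + o I S₀ + d I S                ≡⟨ solve 3 (λ a b c → a :+ b :+ c := a :+ c :+ b) refl (∑∈ S oc) (o I S₀) (d I S) ⟩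
  ∑∈ S oc + d I S + o I S₀                ≤⟨ +-monoˡ-≤ (o I S₀) (paid-for inv terminal) ⟩
  ∑ (α s) + o I S₀                        ≡⟨ cong (_+ o I S₀) (∑-by-fibres μ (α s)) ⟩
  ∑ (charge s μ) + o I S₀                 ≡⟨ sym (∑-distrib-+ (charge s μ) (λ g → if lookup S₀ g then cost g else 0ℚ)) ⟩
  ∑ (λ g → charge s μ g + (if lookup S₀ g then cost g else 0ℚ))
                                          ≤⟨ ∑-mono (facility-charge μ S₀⊆S* μ∈S* run terminal) ⟩
  ∑ (λ g → U g + V g + 2ℚ * W g)          ≡⟨ trans (∑-distrib-+ (λ g → U g + V g) (λ g → 2ℚ * W g))
                                                   (cong₂ _+_ (∑-distrib-+ U V) (sym (*-distribˡ-∑ 2ℚ W))) ⟩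
  o I S* + ∑∈ S₀ AC + 2ℚ * ∑∈ (S* ─ S₀) AC ∎
  where
  open ≤-Reasoning
  open UFL I
  open JMS I (extCost I S₀)
  open RunInvariant I (extCost I S₀)
  open ExtendJMS I S₀
  S = opened s
  oc = extCost I S₀
  inv = invariant-run run (invariant-init extCost-nonNeg)
  AC = assignedCost I μ
  U V W : Fin m → ℚ
  U g = if lookup S* g then cost g else 0ℚ
  V g = if lookup S₀ g then AC g else 0ℚ
  W g = if lookup (S* ─ S₀) g then AC g else 0ℚ
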